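{- For $n\ge 2$, the number of minimum dominating sets of the path $P_n$ is $$\tau(P_n)=\begin{cases}1 & \text{if } n\equiv 0\pmod 3,\\ n+\frac12\lfloor\frac n3\rfloor\left(\lfloor \frac n3\rfloor -1\right) & \text{if } n\equiv 1\pmod 3,\\ 2+\lfloor\frac n3\rfloor & \text{if } n\equiv 2\pmod 3.\end{cases}$$
   Context: All graphs are finite, simple and undirected; $P_n$ is the path on $n$ vertices. A set $D\subseteq V(G)$ is a dominating set of $G$ if every vertex not in $D$ is adjacent to at least one vertex of $D$. The domination number $\gamma(G)$ is the minimum cardinality of a dominating set; a dominating set of cardinality $\gamma(G)$ is a $\gamma(G)$-set. $\tau(G)$ denotes the total number of $\gamma(G)$-sets. -}

module Defs where

open import Data.Nat using (ℕ; zero; suc; _+_; _*_; _∸_; _≤_)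
open import Data.Nat.DivMod using (_/_; _%_)
open import Data.Fin using (Fin; toℕ)
open import Data.Fin.Subset using (Subset; _∈_; ∣_∣)
open import Data.Product using (Σ; _×_; ∃-syntax)
open import Data.Sum using (_⊎_)
open import Data.List using (List; length)
open import Data.List.Relation.Unary.Unique.Propositional using (Unique)
import Data.List.Membership.Propositional as LM
open import Relation.Binary.PropositionalEquality using (_≡_)

PathAdj : (n : ℕ) → Fin n → Fin n → Set
PathAdj n i j = (suc (toℕ i) ≡ toℕ j) ⊎ (suc (toℕ j) ≡ toℕ i)

Dominating : (n : ℕ) → Subset n → Set
Dominating n D = ∀ (v : Fin n) → v ∈ D ⊎ (∃[ u ] (u ∈ D × PathAdj n u v))

GammaSet : (n : ℕ) → Subset n → Set
GammaSet n D = Dominating n D × (∀ (E : Subset n) → Dominating n E → ∣ D ∣ ≤ ∣ E ∣)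

NumGammaSets : (n : ℕ) → ℕ → Set
NumGammaSets n t =
  Σ (List (Subset n)) λ L →
    Unique L × (∀ (D : Subset n) → (D LM.∈ L → GammaSet n D) × (GammaSet n D → D LM.∈ L))
    × length L ≡ t

tauFormula : ℕ → ℕ
tauFormula n with n % 3
... | 0 = 1
... | 1 = n + ((n / 3) * ((n / 3) ∸ 1)) / 2
... | _ = 2 + n / 3

-- A subset of P_n is a word of n bits, and domination of the path is recognised, reading the word
-- from left to right, by a three-state automaton.  Dynamic programming over the automaton yields,
-- for every state and length, the least weight of an accepted word together with the duplicate-free
-- list of all accepted words of that weight; for the initial state these are exactly the
-- γ(P_n)-sets.  Tallying weights and list lengths gives a numerical recursion that is solved in
-- closed form along each residue class mod 3; the number of γ(P_{3m+1})-sets grows by m + 3 from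
-- one period to the next, hence equals 3m + 1 + m(m - 1)/2.
module Submission where

open import Defs
open import Data.Bool using (Bool; true; false)
open import Data.Empty using (⊥; ⊥-elim)
open import Data.Fin using (Fin; zero; suc; toℕ)
open import Data.Fin.Subset using (Subset; ∣_∣) renaming (_∈_ to _∈ₛ_)
open import Data.List using (List; []; _∷_; [_]; _++_; map; length)
open import Data.List.Properties using (length-map; length-++)
open import Data.List.Membership.Propositional using (_∈_)
open import Data.List.Membership.Propositional.Properties
  using (∈-map⁺; ∈-map⁻; ∈-++⁺ˡ; ∈-++⁺ʳ; ∈-++⁻)
open import Data.List.Relation.Unary.Any using (here)
open import Data.List.Relation.Unary.All using ([])
open import Data.List.Relation.Unary.AllPairs using ([]; _∷_)
open import Data.List.Relation.Unary.Unique.Propositional using (Unique)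
import Data.List.Relation.Unary.Unique.Propositional.Properties as Unique
open import Data.Nat using (ℕ; zero; suc; _+_; _*_; _∸_; _≤_; _<_; z≤n; s≤s)
open import Data.Nat.DivMod
  using (_/_; _%_; [m+kn]%n≡m%n; +-distrib-/-∣ʳ; m*n/n≡m; m*n%n≡0; m<n⇒m/n≡0)
open import Data.Nat.Divisibility using (divides-refl)
open import Data.Nat.Properties
  using (suc-injective; <-cmp; <-irrefl; <-asym; <⇒≤; <-≤-trans; ≤-antisym; n<1+n; *-distribʳ-+)
open import Data.Nat.Tactic.RingSolver using (solve-∀)
open import Data.Product using (_×_; _,_; proj₁; proj₂; ∃-syntax; map₁; map₂)
open import Data.Sum using (_⊎_; inj₁; inj₂)
import Data.Sum as Sum
open import Data.Unit using (⊤; tt)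
open import Data.Vec using ([]; _∷_; here; there)
open import Data.Vec.Properties using (∷-injectiveʳ)
open import Function using (id; _∘_)
open import Relation.Binary.Definitions using (tri<; tri≈; tri>)
open import Relation.Binary.PropositionalEquality
  using (_≡_; refl; sym; trans; cong; cong₂; subst)

HasNeighbourIn : ∀ {n} → Subset n → Fin n → Set
HasNeighbourIn {n} D i = ∃[ u ] (u ∈ₛ D × PathAdj n u i)

-- The flag b says whether a virtual vertex just before vertex 0 lies in D.
Dominated : ∀ {n} → Bool → Subset n → Fin n → Set
Dominated b D i = i ∈ₛ D ⊎ HasNeighbourIn D i ⊎ (b ≡ true × toℕ i ≡ 0)

DominatingAfter : ∀ {n} → Bool → Subset n → Set
DominatingAfter b D = ∀ i → Dominated b D i

HeadIn : ∀ {n} → Subset n → Set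
HeadIn []      = ⊥
HeadIn (b ∷ _) = b ≡ true

pathAdj-suc⁻ : ∀ {n} {u i : Fin n} → PathAdj (suc n) (suc u) (suc i) → PathAdj n u i
pathAdj-suc⁻ = Sum.map suc-injective suc-injective

pathAdj-suc⁺ : ∀ {n} {u i : Fin n} → PathAdj n u i → PathAdj (suc n) (suc u) (suc i)
pathAdj-suc⁺ = Sum.map (cong suc) (cong suc)

module _ {n} {l b : Bool} {w : Subset n} where

  dominated-zero⁻ : Dominated l (b ∷ w) zero → b ≡ true ⊎ HeadIn w ⊎ l ≡ true
  dominated-zero⁻ (inj₁ here)                                       = inj₁ refl
  dominated-zero⁻ (inj₂ (inj₁ (suc zero , there here , inj₂ refl))) = inj₂ (inj₁ refl)
  dominated-zero⁻ (inj₂ (inj₂ (l≡true , _)))                        = inj₂ (inj₂ l≡true)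

  dominated-zero⁺ : b ≡ true ⊎ HeadIn w ⊎ l ≡ true → Dominated l (b ∷ w) zero
  dominated-zero⁺ (inj₁ refl)          = inj₁ here
  dominated-zero⁺ (inj₂ (inj₁ h))      = inj₂ (inj₁ (neighbour-zero⁺ w h))
    where
    neighbour-zero⁺ : ∀ {m} (v : Subset m) → HeadIn v → HasNeighbourIn (b ∷ v) zero
    neighbour-zero⁺ (.true ∷ _) refl = suc zero , there here , inj₂ refl
  dominated-zero⁺ (inj₂ (inj₂ l≡true)) = inj₂ (inj₂ (l≡true , refl))

  dominated-suc⁻ : ∀ {i} → Dominated l (b ∷ w) (suc i) → Dominated b w i
  dominated-suc⁻ (inj₁ (there i∈w))                      = inj₁ i∈w
  dominated-suc⁻ (inj₂ (inj₁ (zero , here , inj₁ e)))     = inj₂ (inj₂ (refl , sym (suc-injective e)))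
  dominated-suc⁻ (inj₂ (inj₁ (suc u , there u∈w , adj))) = inj₂ (inj₁ (u , u∈w , pathAdj-suc⁻ adj))

  dominated-suc⁺ : ∀ {i} → Dominated b w i → Dominated l (b ∷ w) (suc i)
  dominated-suc⁺ (inj₁ i∈w)                    = inj₁ (there i∈w)
  dominated-suc⁺ (inj₂ (inj₁ (u , u∈w , adj))) = inj₂ (inj₁ (suc u , there u∈w , pathAdj-suc⁺ adj))
  dominated-suc⁺ (inj₂ (inj₂ (refl , i≡0)))    = inj₂ (inj₁ (zero , here , inj₁ (cong suc (sym i≡0))))

  dominatingAfter-∷⁻ : DominatingAfter l (b ∷ w) →
                       (b ≡ true ⊎ HeadIn w ⊎ l ≡ true) × DominatingAfter b w
  dominatingAfter-∷⁻ d = dominated-zero⁻ (d zero) , λ i → dominated-suc⁻ (d (suc i))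

  dominatingAfter-∷⁺ : b ≡ true ⊎ HeadIn w ⊎ l ≡ true → DominatingAfter b w →
                       DominatingAfter l (b ∷ w)
  dominatingAfter-∷⁺ h d zero    = dominated-zero⁺ h
  dominatingAfter-∷⁺ h d (suc i) = dominated-suc⁺ (d i)

dominatingAfter-true∷ : ∀ {n l} {w : Subset n} → DominatingAfter true w → DominatingAfter l (true ∷ w)
dominatingAfter-true∷ = dominatingAfter-∷⁺ (inj₁ refl)

dominatingAfter-tail : ∀ {n l b} {w : Subset n} → DominatingAfter l (b ∷ w) → DominatingAfter b w
dominatingAfter-tail = proj₂ ∘ dominatingAfter-∷⁻

-- The status after reading a prefix of D: its last vertex is in D (covered), is dominated but not
-- in D (free), or is still undominated, so that the next vertex must be in D (forced).
data Status : Set where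
  covered free forced : Status

Accepts : ∀ {n} → Status → Subset n → Set
Accepts covered []          = ⊤
Accepts free    []          = ⊤
Accepts forced  []          = ⊥
Accepts _       (true ∷ D)  = Accepts covered D
Accepts covered (false ∷ D) = Accepts free D
Accepts free    (false ∷ D) = Accepts forced D
Accepts forced  (false ∷ D) = ⊥

DominatesFrom : ∀ {n} → Status → Subset n → Set
DominatesFrom covered D = DominatingAfter true D
DominatesFrom free    D = DominatingAfter false D
DominatesFrom forced  D = HeadIn D × DominatingAfter false D

accepts⇒dominatesFrom : ∀ {n} s (D : Subset n) → Accepts s D → DominatesFrom s D
accepts⇒dominatesFrom covered []          _ = λ ()
accepts⇒dominatesFrom free    []          _ = λ ()
accepts⇒dominatesFrom covered (true ∷ D)  a = dominatingAfter-true∷ (accepts⇒dominatesFrom covered D a)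
accepts⇒dominatesFrom free    (true ∷ D)  a = dominatingAfter-true∷ (accepts⇒dominatesFrom covered D a)
accepts⇒dominatesFrom forced  (true ∷ D)  a = refl , dominatingAfter-true∷ (accepts⇒dominatesFrom covered D a)
accepts⇒dominatesFrom covered (false ∷ D) a =
  dominatingAfter-∷⁺ (inj₂ (inj₂ refl)) (accepts⇒dominatesFrom free D a)
accepts⇒dominatesFrom free    (false ∷ D) a =
  let (h , d) = accepts⇒dominatesFrom forced D a in dominatingAfter-∷⁺ (inj₂ (inj₁ h)) d

dominatesFrom⇒accepts : ∀ {n} s (D : Subset n) → DominatesFrom s D → Accepts s D
dominatesFrom⇒accepts covered []          _       = tt
dominatesFrom⇒accepts free    []          _       = tt
dominatesFrom⇒accepts covered (true ∷ D)  d       = dominatesFrom⇒accepts covered D (dominatingAfter-tail d)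
dominatesFrom⇒accepts free    (true ∷ D)  d       = dominatesFrom⇒accepts covered D (dominatingAfter-tail d)
dominatesFrom⇒accepts forced  (true ∷ D)  (_ , d) = dominatesFrom⇒accepts covered D (dominatingAfter-tail d)
dominatesFrom⇒accepts covered (false ∷ D) d       = dominatesFrom⇒accepts free D (dominatingAfter-tail d)
dominatesFrom⇒accepts free    (false ∷ D) d       with dominatingAfter-∷⁻ d
... | inj₂ (inj₁ h) , d′ = dominatesFrom⇒accepts forced D (h , d′)

dominating⇒accepts : ∀ {n} (D : Subset n) → Dominating n D → Accepts free D
dominating⇒accepts D d = dominatesFrom⇒accepts free D λ i → Sum.map₂ inj₁ (d i)

accepts⇒dominating : ∀ {n} (D : Subset n) → Accepts free D → Dominating n D
accepts⇒dominating D a i = Sum.map₂ Sum.[ id , (λ { (() , _) }) ] (accepts⇒dominatesFrom free D a i)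

record Optimal {n} (P : Subset n → Set) (o : ℕ × List (Subset n)) : Set where
  field
    lower-bound : ∀ D → P D → proj₁ o ≤ ∣ D ∣
    sound       : ∀ {D} → D ∈ proj₂ o → P D × ∣ D ∣ ≡ proj₁ o
    complete    : ∀ D → P D → ∣ D ∣ ≡ proj₁ o → D ∈ proj₂ o
    unique      : Unique (proj₂ o)
open Optimal

optimal-resp : ∀ {n} {P Q : Subset n → Set} {o} →
               (∀ D → P D → Q D) → (∀ D → Q D → P D) → Optimal P o → Optimal Q o
optimal-resp P⇒Q Q⇒P opt = record
  { lower-bound = λ D q → lower-bound opt D (Q⇒P D q)
  ; sound       = λ D∈ → let (p , e) = sound opt D∈ in P⇒Q _ p , e
  ; complete    = λ D q → complete opt D (Q⇒P D q)
  ; unique      = unique opt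
  }

optimal-nil : ∀ {P : Subset 0 → Set} → P [] → Optimal P (0 , [ [] ])
optimal-nil p = record
  { lower-bound = λ _ _ → z≤n
  ; sound       = λ { (here refl) → p , refl }
  ; complete    = λ { [] _ _ → here refl }
  ; unique      = [] ∷ []
  }

withHead : ∀ {n} → Bool → ℕ × List (Subset n) → ℕ × List (Subset (suc n))
withHead true  (k , L) = suc k , map (true ∷_) L
withHead false (k , L) = k , map (false ∷_) L

module _ {n} {R : Subset (suc n) → Set} where

  sound-true∷ : ∀ {a} → Optimal (R ∘ (true ∷_)) a →
                ∀ {D} → D ∈ proj₂ (withHead true a) → R D × ∣ D ∣ ≡ suc (proj₁ a)
  sound-true∷ oa D∈ with ∈-map⁻ (true ∷_) D∈
  ... | _ , D′∈ , refl = let (r , e) = sound oa D′∈ in r , cong suc e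

  sound-false∷ : ∀ {b} → Optimal (R ∘ (false ∷_)) b →
                 ∀ {D} → D ∈ proj₂ (withHead false b) → R D × ∣ D ∣ ≡ proj₁ b
  sound-false∷ ob D∈ with ∈-map⁻ (false ∷_) D∈
  ... | _ , D′∈ , refl = sound ob D′∈

  optimal-true∷ : ∀ {a} → Optimal (R ∘ (true ∷_)) a →
                  (∀ D → R (false ∷ D) → suc (proj₁ a) < ∣ D ∣) → Optimal R (withHead true a)
  optimal-true∷ oa above = record
    { lower-bound = λ { (true ∷ D) r → s≤s (lower-bound oa D r) ; (false ∷ D) r → <⇒≤ (above D r) }
    ; sound       = sound-true∷ oa
    ; complete    = λ { (true ∷ D) r e → ∈-map⁺ (true ∷_) (complete oa D r (suc-injective e))
                      ; (false ∷ D) r e → ⊥-elim (<-irrefl (sym e) (above D r)) }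
    ; unique      = Unique.map⁺ ∷-injectiveʳ (unique oa)
    }

  optimal-false∷ : ∀ {b} → Optimal (R ∘ (false ∷_)) b →
                   (∀ D → R (true ∷ D) → proj₁ b < suc ∣ D ∣) → Optimal R (withHead false b)
  optimal-false∷ ob below = record
    { lower-bound = λ { (true ∷ D) r → <⇒≤ (below D r) ; (false ∷ D) r → lower-bound ob D r }
    ; sound       = sound-false∷ ob
    ; complete    = λ { (true ∷ D) r e → ⊥-elim (<-irrefl (sym e) (below D r))
                      ; (false ∷ D) r e → ∈-map⁺ (false ∷_) (complete ob D r e) }
    ; unique      = Unique.map⁺ ∷-injectiveʳ (unique ob)
    }

  optimal-++ : ∀ {a b} → Optimal (R ∘ (true ∷_)) a → Optimal (R ∘ (false ∷_)) b →
               suc (proj₁ a) ≡ proj₁ b →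
               Optimal R (suc (proj₁ a) , proj₂ (withHead true a) ++ proj₂ (withHead false b))
  optimal-++ {a} {b} oa ob tie = record
    { lower-bound = λ { (true ∷ D) r → s≤s (lower-bound oa D r)
                      ; (false ∷ D) r → subst (_≤ ∣ D ∣) (sym tie) (lower-bound ob D r) }
    ; sound       = Sum.[ sound-true∷ oa , sound-false∷′ ] ∘ ∈-++⁻ (proj₂ (withHead true a))
    ; complete    = λ { (true ∷ D) r e → ∈-++⁺ˡ (∈-map⁺ (true ∷_) (complete oa D r (suc-injective e)))
                      ; (false ∷ D) r e → ∈-++⁺ʳ (proj₂ (withHead true a))
                                                  (∈-map⁺ (false ∷_) (complete ob D r (trans e tie))) }
    ; unique      = Unique.++⁺ (Unique.map⁺ ∷-injectiveʳ (unique oa)) (Unique.map⁺ ∷-injectiveʳ (unique ob))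
                               heads-differ
    }
    where
    sound-false∷′ : ∀ {D} → D ∈ proj₂ (withHead false b) → R D × ∣ D ∣ ≡ suc (proj₁ a)
    sound-false∷′ D∈ = let (r , e) = sound-false∷ ob D∈ in r , trans e (sym tie)

    heads-differ : ∀ {D} → D ∈ proj₂ (withHead true a) × D ∈ proj₂ (withHead false b) → ⊥
    heads-differ (D∈a , D∈b) with ∈-map⁻ (true ∷_) D∈a | ∈-map⁻ (false ∷_) D∈b
    ... | _ , _ , refl | _ , _ , ()

module _ {A : Set} (_∙_ : A → A → A) where

  merge : ℕ × A → ℕ × A → ℕ × A
  merge (v , x) (w , y) with <-cmp v w
  ... | tri< _ _ _ = v , x
  ... | tri≈ _ _ _ = v , x ∙ y
  ... | tri> _ _ _ = w , y

  merge-≡ : ∀ {v w x y} → v ≡ w → merge (v , x) (w , y) ≡ (v , x ∙ y)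
  merge-≡ {v} {w} v≡w with <-cmp v w
  ... | tri< v<w _ _ = ⊥-elim (<-irrefl v≡w v<w)
  ... | tri≈ _ _ _   = refl
  ... | tri> _ _ w<v = ⊥-elim (<-irrefl (sym v≡w) w<v)

  merge-> : ∀ {v w x y} → w < v → merge (v , x) (w , y) ≡ (w , y)
  merge-> {v} {w} w<v with <-cmp v w
  ... | tri< v<w _ _ = ⊥-elim (<-asym v<w w<v)
  ... | tri≈ _ v≡w _ = ⊥-elim (<-irrefl (sym v≡w) w<v)
  ... | tri> _ _ _   = refl

optimal-merge : ∀ {n} {R : Subset (suc n) → Set} {a b} →
                Optimal (R ∘ (true ∷_)) a → Optimal (R ∘ (false ∷_)) b →
                Optimal R (merge _++_ (withHead true a) (withHead false b))
optimal-merge {a = a} {b} oa ob with <-cmp (suc (proj₁ a)) (proj₁ b)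
... | tri< a<b _ _ = optimal-true∷ oa λ D r → <-≤-trans a<b (lower-bound ob D r)
... | tri≈ _ tie _ = optimal-++ oa ob tie
... | tri> _ _ b<a = optimal-false∷ ob λ D r → <-≤-trans b<a (s≤s (lower-bound oa D r))

-- Nothing is accepted from `forced` at length 0; the weight 1 stands for ∞
-- (with weight 0 the list `optimal free 1` would come out empty).
optimal : Status → (n : ℕ) → ℕ × List (Subset n)
optimal covered zero    = 0 , [ [] ]
optimal free    zero    = 0 , [ [] ]
optimal forced  zero    = 1 , []
optimal covered (suc n) = merge _++_ (withHead true (optimal covered n)) (withHead false (optimal free n))
optimal free    (suc n) = merge _++_ (withHead true (optimal covered n)) (withHead false (optimal forced n))
optimal forced  (suc n) = withHead true (optimal covered n)

optimal-correct : ∀ s n → Optimal (Accepts s) (optimal s n)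
optimal-correct covered zero    = optimal-nil tt
optimal-correct free    zero    = optimal-nil tt
optimal-correct forced  zero    =
  record { lower-bound = λ { [] () } ; sound = λ () ; complete = λ { [] () } ; unique = [] }
optimal-correct covered (suc n) = optimal-merge (optimal-correct covered n) (optimal-correct free n)
optimal-correct free    (suc n) = optimal-merge (optimal-correct covered n) (optimal-correct forced n)
optimal-correct forced  (suc n) = optimal-true∷ (optimal-correct covered n) λ _ ()

numGammaSets : ∀ {n k} {o : ℕ × List (Subset n)} → Optimal (Dominating n) o →
               length (proj₂ o) ≡ suc k → NumGammaSets n (suc k)
numGammaSets {n} {o = _ , W ∷ Ws} opt len =
  W ∷ Ws , unique opt , (λ D → member⇒gammaSet D , gammaSet⇒member D) , len
  where
  member⇒gammaSet : ∀ D → D ∈ W ∷ Ws → GammaSet n D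
  member⇒gammaSet D D∈ =
    let (d , e) = sound opt D∈ in d , λ E dE → subst (_≤ ∣ E ∣) (sym e) (lower-bound opt E dE)

  gammaSet⇒member : ∀ D → GammaSet n D → D ∈ W ∷ Ws
  gammaSet⇒member D (d , minimum) =
    let (dW , eW) = sound opt (here refl)
    in  complete opt D d (≤-antisym (subst (∣ D ∣ ≤_) eW (minimum W dW)) (lower-bound opt D d))

tally : ∀ {A : Set} → ℕ × List A → ℕ × ℕ
tally = map₂ length

tally-merge : ∀ {A : Set} (a b : ℕ × List A) → tally (merge _++_ a b) ≡ merge _+_ (tally a) (tally b)
tally-merge (v , xs) (w , ys) with <-cmp v w
... | tri< _ _ _ = refl
... | tri≈ _ _ _ = cong (v ,_) (length-++ xs)
... | tri> _ _ _ = refl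

tally-true∷ : ∀ {n} (a : ℕ × List (Subset n)) → tally (withHead true a) ≡ map₁ suc (tally a)
tally-true∷ (k , L) = cong (suc k ,_) (length-map _ L)

tally-false∷ : ∀ {n} (b : ℕ × List (Subset n)) → tally (withHead false b) ≡ tally b
tally-false∷ (k , L) = cong (k ,_) (length-map _ L)

tally-merge-withHead : ∀ {n} (a b : ℕ × List (Subset n)) →
  tally (merge _++_ (withHead true a) (withHead false b)) ≡ merge _+_ (map₁ suc (tally a)) (tally b)
tally-merge-withHead a b =
  trans (tally-merge (withHead true a) (withHead false b)) (cong₂ (merge _+_) (tally-true∷ a) (tally-false∷ b))

Profile : Set
Profile = (ℕ × ℕ) × (ℕ × ℕ) × (ℕ × ℕ)

-- Opaque, as otherwise unifying `profile` at two spellings of the same length unfolds the whole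
-- table, which is very slow.
opaque
  profile : ℕ → Profile
  profile n = tally (optimal covered n) , tally (optimal free n) , tally (optimal forced n)

step : Profile → Profile
step (c , f , r) = merge _+_ (map₁ suc c) f , merge _+_ (map₁ suc c) r , map₁ suc c

opaque
  unfolding profile

  profile-zero : profile 0 ≡ ((0 , 1) , (0 , 1) , (1 , 0))
  profile-zero = refl

  profile-suc : ∀ n → profile (suc n) ≡ step (profile n)
  profile-suc n = cong₂ _,_ (tally-merge-withHead (optimal covered n) (optimal free n))
                 (cong₂ _,_ (tally-merge-withHead (optimal covered n) (optimal forced n))
                            (tally-true∷ (optimal covered n)))

  profile-free : ∀ n {c f r} → profile n ≡ (c , f , r) → tally (optimal free n) ≡ f
  profile-free n refl = refl

profile-step : ∀ {n p q} → profile n ≡ p → step p ≡ q → profile (suc n) ≡ q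
profile-step {n} eq stp = trans (profile-suc n) (trans (cong step eq) stp)

triangle : ℕ → ℕ
triangle zero    = 0
triangle (suc m) = triangle m + m

triangle-closed : ∀ m → m * (m ∸ 1) / 2 ≡ triangle m
triangle-closed m = trans (cong (_/ 2) (sym (twice m))) (m*n/n≡m (triangle m) 2)
  where
  twice : ∀ m → triangle m * 2 ≡ m * (m ∸ 1)
  twice zero          = refl
  twice (suc zero)    = refl
  twice (suc (suc k)) = trans (*-distribʳ-+ 2 (triangle (suc k)) (suc k))
                              (trans (cong (_+ suc k * 2) (twice (suc k))) (ring k))
    where
    ring : ∀ k → suc k * k + suc k * 2 ≡ suc (suc k) * suc k
    ring = solve-∀

τ₃ₘ₊₁ : ℕ → ℕ
τ₃ₘ₊₁ m = suc (m * 3) + triangle m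

profile₁ profile₂ profile₃ : ℕ → Profile
profile₁ m = (m , 1)                 , (suc m , τ₃ₘ₊₁ m) , (suc m , suc m)
profile₂ m = (suc m , suc (τ₃ₘ₊₁ m)) , (suc m , 2 + m)   , (suc m , 1)
profile₃ m = (suc m , 2 + m)         , (suc m , 1)       , (2 + m , suc (τ₃ₘ₊₁ m))

step-profile₁ : ∀ m → step (profile₁ m) ≡ profile₂ m
step-profile₁ m = cong₂ _,_ (merge-≡ _+_ refl) (cong₂ _,_ (merge-≡ _+_ refl) refl)

step-profile₂ : ∀ m → step (profile₂ m) ≡ profile₃ m
step-profile₂ m = cong₂ _,_ (merge-> _+_ (n<1+n (suc m))) (cong₂ _,_ (merge-> _+_ (n<1+n (suc m))) refl)

step-profile₃ : ∀ m → step (profile₃ m) ≡ profile₁ (suc m)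
step-profile₃ m = cong₂ _,_ (merge-> _+_ (n<1+n (suc m)))
  (cong₂ _,_ (trans (merge-≡ _+_ refl) (cong (2 + m ,_) (τ₃ₘ₊₁-suc m (triangle m)))) refl)
  where
  τ₃ₘ₊₁-suc : ∀ m t → 2 + m + suc (suc (m * 3 + t)) ≡ suc (suc m * 3 + (t + m))
  τ₃ₘ₊₁-suc = solve-∀

profile-3m+1 : ∀ m → profile (1 + m * 3) ≡ profile₁ m
profile-3m+2 : ∀ m → profile (2 + m * 3) ≡ profile₂ m
profile-3m+3 : ∀ m → profile (3 + m * 3) ≡ profile₃ m
profile-3m+1 zero    = profile-step profile-zero refl
profile-3m+1 (suc m) = profile-step (profile-3m+3 m) (step-profile₃ m)
profile-3m+2 m       = profile-step (profile-3m+1 m) (step-profile₁ m)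
profile-3m+3 m       = profile-step (profile-3m+2 m) (step-profile₂ m)

numGammaSets-profile : ∀ n {c w k r} → profile n ≡ (c , (w , suc k) , r) → NumGammaSets n (suc k)
numGammaSets-profile n eq =
  numGammaSets (optimal-resp accepts⇒dominating dominating⇒accepts (optimal-correct free n))
               (cong proj₂ (profile-free n eq))

data Residue3 : ℕ → Set where
  rem₀ : ∀ m → Residue3 (m * 3)
  rem₁ : ∀ m → Residue3 (1 + m * 3)
  rem₂ : ∀ m → Residue3 (2 + m * 3)

residue3 : ∀ n → Residue3 n
residue3 zero    = rem₀ 0
residue3 (suc n) with residue3 n
... | rem₀ m = rem₁ m
... | rem₁ m = rem₂ m
... | rem₂ m = rem₀ (suc m)

[r+m*3]/3≡m : ∀ r m → r < 3 → (r + m * 3) / 3 ≡ m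
[r+m*3]/3≡m r m r<3 =
  trans (+-distrib-/-∣ʳ r (divides-refl m)) (cong₂ _+_ (m<n⇒m/n≡0 r<3) (m*n/n≡m m 3))

tauFormula-3m : ∀ m → tauFormula (m * 3) ≡ 1
tauFormula-3m m with (m * 3) % 3 | m*n%n≡0 m 3
... | .0 | refl = refl

tauFormula-3m+1 : ∀ m → tauFormula (1 + m * 3) ≡ τ₃ₘ₊₁ m
tauFormula-3m+1 m with (1 + m * 3) % 3 | [m+kn]%n≡m%n 1 m 3
... | .1 | refl = cong (1 + m * 3 +_)
  (trans (cong (λ q → q * (q ∸ 1) / 2) ([r+m*3]/3≡m 1 m (s≤s (s≤s z≤n)))) (triangle-closed m))

tauFormula-3m+2 : ∀ m → tauFormula (2 + m * 3) ≡ 2 + m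
tauFormula-3m+2 m with (2 + m * 3) % 3 | [m+kn]%n≡m%n 2 m 3
... | .2 | refl = cong (2 +_) ([r+m*3]/3≡m 2 m (s≤s (s≤s (s≤s z≤n))))

theorem5p1 : ∀ (n : ℕ) → 2 ≤ n → NumGammaSets n (tauFormula n)
theorem5p1 n _ with residue3 n
... | rem₀ zero    = numGammaSets-profile 0 profile-zero
... | rem₀ (suc m) =
  subst (NumGammaSets _) (sym (tauFormula-3m (suc m))) (numGammaSets-profile _ (profile-3m+3 m))
... | rem₁ m       =
  subst (NumGammaSets _) (sym (tauFormula-3m+1 m)) (numGammaSets-profile _ (profile-3m+1 m))
... | rem₂ m       =
  subst (NumGammaSets _) (sym (tauFormula-3m+2 m)) (numGammaSets-profile _ (profile-3m+2 m))
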